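{- Let $n$ be a positive integer and let $B_n$, $\epsilon$, $\phi$ be as in the context. Let $\sigma=(i_1\,\dots\,i_k)\in S_n\le B_n$ be a $k$-cycle and let $\tau=e_{i_1}+\dots+e_{i_k}\in(\mathbb Z/2\mathbb Z)^n\le B_n$. Then $\phi(\sigma,\tau)=\epsilon^{k-1}$. Moreover, for every $\alpha\in S_n\le B_n$ with $\alpha(i_1)=i_1,\dots,\alpha(i_k)=i_k$, we have $\phi(\alpha,\tau)=1$.
   Context: Let $B_n=(\mathbb Z/2\mathbb Z)^n\rtimes S_n$ be the hyperoctahedral group, where $S_n$ acts on $(\mathbb Z/2\mathbb Z)^n$ by permuting coordinates ($\sigma(e_i)=e_{\sigma(i)}$, $e_i$ the $i$th unit vector); $S_n$ and $(\mathbb Z/2\mathbb Z)^n$ are viewed as subgroups of $B_n$. Let $H_n$ be the set of pairs $(a,b)\in(\mathbb Z/2\mathbb Z)^n\times\mathbb Z/2\mathbb Z$ with the group law $(a_1,b_1)(a_2,b_2)=(a_1+a_2,\ b_1+b_2+\sum_{1\le i<j\le n}a_{1,i}a_{2,j})$. Put $x_i=(e_i,0)$, $\epsilon=(0,1)$; then $H_n$ is presented by generators $x_1,\dots,x_n,\epsilon$ with relations $x_i^2=\epsilon^2=1$, $x_ix_j=\epsilon x_jx_i$ ($i\ne j$), $\epsilon x_i=x_i\epsilon$. $S_n$ acts on $H_n$ by automorphisms via $\sigma(x_i)=x_{\sigma(i)}$, $\sigma(\epsilon)=\epsilon$; let $G_n=H_n\rtimes S_n$. Then $\epsilon$ is central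 in $G_n$ and $G_n/\{1,\epsilon\}\cong B_n$ (induced by $(a,b)\mapsto a$ on $H_n$ and the identity on $S_n$), so $G_n$ is a central extension of $B_n$ by $\mathbb Z/2\mathbb Z$. For commuting $\sigma,\tau\in B_n$ with lifts $\widetilde\sigma,\widetilde\tau\in G_n$, define $\phi(\sigma,\tau)=\widetilde\sigma\widetilde\tau\widetilde\sigma^{ -1}\widetilde\tau^{ -1}\in\{1,\epsilon\}$, which is independent of the choice of lifts. -}

module Defs where

open import Data.Bool using (Bool; true; false; _xor_; _∧_; if_then_else_)
open import Data.Nat using (ℕ; zero; suc)
open import Data.Fin using (Fin; zero; suc; _≟_; _<?_)
open import Data.Fin.Permutation using (Permutation′; _⟨$⟩ʳ_; id; flip; _∘ₚ_)
open import Data.Product using (_×_; _,_; proj₁; proj₂)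
open import Data.List using (List; foldr; map; allFin)
open import Relation.Nullary.Decidable using (⌊_⌋)
open import Relation.Binary.PropositionalEquality using (_≡_; _≢_)
open import Function.Definitions using (Injective)

private variable n : ℕ

Perm : ℕ → Set
Perm = Permutation′

-- (Z/2Z)^n, elements as functions Fin n → Bool (true = 1)
V : ℕ → Set
V n = Fin n → Bool

0V : V n
0V _ = false

_+V_ : V n → V n → V n
(a +V b) i = a i xor b i

e : Fin n → V n
e i j = ⌊ i ≟ j ⌋

⊕ : List Bool → Bool
⊕ = foldr _xor_ false

pairSum : V n → V n → Bool
pairSum {n} a b =
  ⊕ (map (λ i → ⊕ (map (λ j → ⌊ i <? j ⌋ ∧ (a i ∧ b j)) (allFin n))) (allFin n))

H : ℕ → Set
H n = V n × Bool

_·H_ : H n → H n → H n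
(a₁ , b₁) ·H (a₂ , b₂) = (a₁ +V a₂ , (b₁ xor b₂) xor pairSum a₁ a₂)

1H : H n
1H = (0V , false)

xH : Fin n → H n
xH i = (e i , false)

εH : H n
εH = (0V , true)

invH : H n → H n
invH (a , b) = (a , b xor pairSum a a)

epsPow : ℕ → H n
epsPow zero    = 1H
epsPow (suc m) = εH ·H epsPow m

prodH : List (H n) → H n
prodH = foldr _·H_ 1H

wordH : (Fin n → Fin n) → V n → H n
wordH {n} f a = prodH (map (λ i → if a i then xH (f i) else 1H) (allFin n))

-- Action of S_n on H_n by the automorphism with σ(x_i) = x_{σ(i)}, σ(ε) = ε:
-- write (a , b) = (∏_{i increasing, a_i = 1} x_i) · ε^c  and apply σ to each factor.
actH : Perm n → H n → H n
actH σ (a , b) = wordH (σ ⟨$⟩ʳ_) a ·H (0V , b xor proj₂ (wordH (λ i → i) a))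

G : ℕ → Set
G n = H n × Perm n

-- composition of permutations: (σ₁ σ₂)(x) = σ₁ (σ₂ x)
_·S_ : Perm n → Perm n → Perm n
σ₁ ·S σ₂ = σ₂ ∘ₚ σ₁

_·G_ : G n → G n → G n
(h₁ , σ₁) ·G (h₂ , σ₂) = (h₁ ·H actH σ₁ h₂ , σ₁ ·S σ₂)

invG : G n → G n
invG (h , σ) = (actH (flip σ) (invH h) , flip σ)

commG : G n → G n → G n
commG g h = ((g ·G h) ·G invG g) ·G invG h

inH : H n → G n
inH h = (h , id)

_≈G_ : G n → G n → Set
((a , b) , σ) ≈G ((a′ , b′) , σ′) =
  (∀ i → a i ≡ a′ i) × (b ≡ b′) × (∀ i → σ ⟨$⟩ʳ i ≡ σ′ ⟨$⟩ʳ i)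

-- B_n = (Z/2Z)^n ⋊ S_n (as a set) and the projection G_n → B_n

B : ℕ → Set
B n = V n × Perm n

_≈B_ : B n → B n → Set
(a , σ) ≈B (a′ , σ′) = (∀ i → a i ≡ a′ i) × (∀ i → σ ⟨$⟩ʳ i ≡ σ′ ⟨$⟩ʳ i)

projG : G n → B n
projG ((a , b) , σ) = (a , σ)

inS : Perm n → B n
inS σ = (0V , σ)

inV : V n → B n
inV a = (a , id)

IsLift : G n → B n → Set
IsLift g β = projG g ≈B β

-- j ↦ j + 1 mod k on Fin k, k = suc m
next : ∀ {m} → Fin (suc m) → Fin (suc m)
next {zero}  zero    = zero
next {suc m} zero    = suc zero
next {suc m} (suc j) with next {m} j
... | zero  = zero
... | suc l = suc (suc l)

-- σ is the k-cycle (i₁ … i_k), k = suc m, with i : Fin k → Fin n injective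
IsCycle : ∀ {m} → (Fin (suc m) → Fin n) → Perm n → Set
IsCycle {n} {m} i σ =
  Injective _≡_ _≡_ i
  × (∀ j → σ ⟨$⟩ʳ i j ≡ i (next j))
  × (∀ (x : Fin n) → (∀ j → i j ≢ x) → σ ⟨$⟩ʳ x ≡ x)

sumE : ∀ {m} → (Fin m → Fin n) → V n
sumE {n} {m} i = foldr _+V_ 0V (map (λ j → e (i j)) (allFin m))

-- The central component of a word x_{l₁} ⋯ x_{l_r} in H_n is the parity of the number of pairs
-- s < t with l_s < l_t. Applying π ∈ S_n to the letters therefore changes it by the parity of the
-- inversions of π among the letters; this is a quadratic form in the multiplicity vector mod 2 of
-- the word, so it only depends on the element a ∈ (Z/2Z)^n the word represents. Hence π acts on
-- H_n by (a , b) ↦ (a ∘ π⁻¹ , b + Q_π(a)), and a direct computation shows that the commutator of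
-- lifts of π and of a vector v with v ∘ π = v is ε^{Q_π(v)}.
-- For the k-cycle σ, the word x_{i₁} ⋯ x_{i_k} is mapped to its rotation x_{i₂} ⋯ x_{i_k} x_{i₁},
-- which reverses exactly the k − 1 pairs containing i₁, so Q_σ(τ) = k − 1; a permutation α fixing
-- every i_j leaves the word unchanged, so Q_α(τ) = 0.

module Submission where

open import Defs
open import Algebra.Bundles using (CommutativeRing)
open import Data.Bool using (Bool; true; false; not; _xor_; _∧_; if_then_else_)
open import Data.Bool.Properties
  using (xor-∧-commutativeRing; xor-identityʳ; xor-comm; xor-assoc; xor-same; xor-inverseʳ;
         xor-annihilates-not; ∧-zeroʳ; ∧-comm; ∧-distribˡ-xor; ∧-distribʳ-xor)
open import Data.Empty using (⊥-elim)
open import Data.Fin using (Fin; zero; suc; _≟_; _<?_)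
open import Data.Fin.Permutation using (_⟨$⟩ʳ_; _⟨$⟩ˡ_; inverseʳ; flip)
open import Data.Fin.Properties using (<-cmp; <-irrefl; <-asym)
open import Data.List using (List; []; _∷_; _++_; [_]; foldr; map; allFin; tabulate; filterᵇ)
open import Data.List.Properties using (map-∘; map-cong; map-id; map-++; map-tabulate; tabulate-cong)
open import Data.Maybe using (Maybe; just; nothing)
open import Data.Nat using (ℕ; zero; suc; _≤_)
open import Data.Product using (_×_; _,_; proj₁; proj₂)
open import Function using (_∘_; Injection)
open import Function.Properties.Inverse using (↔⇒↣)
open import Function.Definitions using (Injective)
open import Level using (0ℓ)
open import Relation.Binary.Definitions using (tri<; tri≈; tri>)
open import Relation.Binary.PropositionalEquality using (_≡_; _≢_; refl; sym; trans; cong; cong₂; subst; module ≡-Reasoning)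
open import Relation.Nullary using (Dec; yes; no; ¬_)
open import Relation.Nullary.Decidable using (⌊_⌋; ⌊⌋-map′; isYes≗does; dec-true; dec-false)
open import Tactic.RingSolver using (solve-∀)
open import Tactic.RingSolver.Core.AlmostCommutativeRing using (AlmostCommutativeRing; fromCommutativeRing)

open CommutativeRing xor-∧-commutativeRing using (semiring; +-commutativeSemigroup)
open import Algebra.Properties.Semiring.Sum semiring
  using (sum; sum-syntax; sum-cong-≗; sum-replicate-zero; ∑-distrib-+; *-distribˡ-sum)
open import Algebra.Properties.CommutativeSemigroup +-commutativeSemigroup
  using (interchange; x∙yz≈y∙xz)

open ≡-Reasoning

private variable n : ℕ

xor-∧-almostCommutativeRing : AlmostCommutativeRing 0ℓ 0ℓ
xor-∧-almostCommutativeRing = fromCommutativeRing xor-∧-commutativeRing false?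
  where
  false? : (b : Bool) → Maybe (false ≡ b)
  false? false = just refl
  false? true  = nothing

⌊⌋-yes : ∀ {p} {P : Set p} (d : Dec P) → P → ⌊ d ⌋ ≡ true
⌊⌋-yes d p = trans (isYes≗does d) (dec-true d p)

⌊⌋-no : ∀ {p} {P : Set p} (d : Dec P) → ¬ P → ⌊ d ⌋ ≡ false
⌊⌋-no d ¬p = trans (isYes≗does d) (dec-false d ¬p)

<?-irrefl : (x : Fin n) → ⌊ x <? x ⌋ ≡ false
<?-irrefl x = ⌊⌋-no (x <? x) (<-irrefl refl)

<?-swap : {x y : Fin n} → x ≢ y → ⌊ y <? x ⌋ ≡ not ⌊ x <? y ⌋
<?-swap {x = x} {y} x≢y with <-cmp x y
... | tri< x<y _ _ = trans (⌊⌋-no (y <? x) (<-asym x<y)) (cong not (sym (⌊⌋-yes (x <? y) x<y)))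
... | tri≈ _ x≡y _ = ⊥-elim (x≢y x≡y)
... | tri> _ _ y<x = trans (⌊⌋-yes (y <? x) y<x) (cong not (sym (⌊⌋-no (x <? y) (<-asym y<x))))

e-sym : (x y : Fin n) → e x y ≡ e y x
e-sym x y with x ≟ y
... | yes refl = sym (⌊⌋-yes (x ≟ x) refl)
... | no x≢y   = sym (⌊⌋-no (y ≟ x) (x≢y ∘ sym))

e-injective : {f : Fin n → Fin n} → Injective _≡_ _≡_ f → (x y : Fin n) → e (f x) (f y) ≡ e x y
e-injective {f = f} inj x y with x ≟ y
... | yes refl = ⌊⌋-yes (f x ≟ f x) refl
... | no x≢y   = ⌊⌋-no (f x ≟ f y) (x≢y ∘ inj)

⊕-tabulate : (F : Fin n → Bool) → ⊕ (tabulate F) ≡ sum F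
⊕-tabulate {zero}  F = refl
⊕-tabulate {suc n} F = cong (F zero xor_) (⊕-tabulate (F ∘ suc))

⊕-allFin : (F : Fin n → Bool) → ⊕ (map F (allFin n)) ≡ sum F
⊕-allFin F = trans (cong ⊕ (map-tabulate (λ x → x) F)) (⊕-tabulate F)

∑-false : {F : Fin n → Bool} → (∀ q → F q ≡ false) → sum F ≡ false
∑-false {n} F≡false = trans (sum-cong-≗ F≡false) (sum-replicate-zero n)

∑-sift : (x : Fin n) (F : Fin n → Bool) → ∑[ q < n ] (e x q ∧ F q) ≡ F x
∑-sift {suc n} zero    F = trans (cong (F zero xor_) (sum-replicate-zero n)) (xor-identityʳ (F zero))
∑-sift {suc n} (suc x) F = begin
  ∑[ q < n ] (⌊ suc x ≟ suc q ⌋ ∧ F (suc q)) ≡⟨ sum-cong-≗ (λ q → cong (_∧ F (suc q)) (⌊⌋-map′ _ _ (x ≟ q))) ⟩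
  ∑[ q < n ] (e x q ∧ F (suc q))             ≡⟨ ∑-sift x (F ∘ suc) ⟩
  F (suc x)                                  ∎

∑₂ : (Fin n → Fin n → Bool) → Bool
∑₂ {n} F = ∑[ p < n ] ∑[ q < n ] F p q

∑₂-distrib-xor : (F G : Fin n → Fin n → Bool) → ∑₂ (λ p q → F p q xor G p q) ≡ ∑₂ F xor ∑₂ G
∑₂-distrib-xor F G = trans (sum-cong-≗ (λ p → ∑-distrib-+ (F p) (G p))) (∑-distrib-+ (λ p → ∑[ q < _ ] F p q) (λ p → ∑[ q < _ ] G p q))

∑₂-false : {F : Fin n → Fin n → Bool} → (∀ p q → F p q ≡ false) → ∑₂ F ≡ false
∑₂-false F≡false = ∑-false (λ p → ∑-false (F≡false p))

∑₂-cong : {F G : Fin n → Fin n → Bool} → (∀ p q → F p q ≡ G p q) → ∑₂ F ≡ ∑₂ G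
∑₂-cong F≡G = sum-cong-≗ (λ p → sum-cong-≗ (F≡G p))

pairSum≡∑₂ : (a b : V n) → pairSum a b ≡ ∑₂ (λ i j → ⌊ i <? j ⌋ ∧ (a i ∧ b j))
pairSum≡∑₂ {n} a b = trans (⊕-allFin (λ i → ⊕ (map (λ j → ⌊ i <? j ⌋ ∧ (a i ∧ b j)) (allFin n))))
  (sum-cong-≗ (λ i → ⊕-allFin (λ j → ⌊ i <? j ⌋ ∧ (a i ∧ b j))))

pairSum-cong : {a a′ b b′ : V n} → (∀ i → a i ≡ a′ i) → (∀ j → b j ≡ b′ j) → pairSum a b ≡ pairSum a′ b′
pairSum-cong {a = a} {a′} {b} {b′} a≗a′ b≗b′ = begin
  pairSum a b                                    ≡⟨ pairSum≡∑₂ a b ⟩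
  ∑₂ (λ i j → ⌊ i <? j ⌋ ∧ (a i ∧ b j))          ≡⟨ ∑₂-cong (λ i j → cong₂ (λ u v → ⌊ i <? j ⌋ ∧ (u ∧ v)) (a≗a′ i) (b≗b′ j)) ⟩
  ∑₂ (λ i j → ⌊ i <? j ⌋ ∧ (a′ i ∧ b′ j))        ≡⟨ pairSum≡∑₂ a′ b′ ⟨
  pairSum a′ b′                                  ∎

pairSum-zeroˡ : (b : V n) → pairSum 0V b ≡ false
pairSum-zeroˡ {n} b = trans (pairSum≡∑₂ 0V b) (∑₂-false {n} (λ i j → ∧-zeroʳ ⌊ i <? j ⌋))

pairSum-zeroʳ : (a : V n) → pairSum a 0V ≡ false
pairSum-zeroʳ {n} a = trans (pairSum≡∑₂ a 0V)
  (∑₂-false {n} (λ i j → trans (cong (⌊ i <? j ⌋ ∧_) (∧-zeroʳ (a i))) (∧-zeroʳ ⌊ i <? j ⌋)))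

pairSum-e : (x : Fin n) (v : V n) → pairSum (e x) v ≡ ∑[ q < n ] (⌊ x <? q ⌋ ∧ v q)
pairSum-e {n} x v = begin
  pairSum (e x) v                                        ≡⟨ pairSum≡∑₂ (e x) v ⟩
  ∑₂ (λ p q → ⌊ p <? q ⌋ ∧ (e x p ∧ v q))                ≡⟨ ∑₂-cong (λ p q → ∧-left-comm ⌊ p <? q ⌋ (e x p) (v q)) ⟩
  ∑₂ (λ p q → e x p ∧ (⌊ p <? q ⌋ ∧ v q))                ≡⟨ sum-cong-≗ (λ p → *-distribˡ-sum (e x p) (λ q → ⌊ p <? q ⌋ ∧ v q)) ⟨
  ∑[ p < n ] (e x p ∧ ∑[ q < n ] (⌊ p <? q ⌋ ∧ v q))     ≡⟨ ∑-sift x (λ p → ∑[ q < n ] (⌊ p <? q ⌋ ∧ v q)) ⟩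
  ∑[ q < n ] (⌊ x <? q ⌋ ∧ v q)                          ∎
  where
  ∧-left-comm : ∀ a b c → a ∧ (b ∧ c) ≡ b ∧ (a ∧ c)
  ∧-left-comm = solve-∀ xor-∧-almostCommutativeRing

mult₂ : List (Fin n) → V n
mult₂ L = foldr _+V_ 0V (map e L)

mult₂-++ : (L M : List (Fin n)) (j : Fin n) → mult₂ (L ++ M) j ≡ mult₂ L j xor mult₂ M j
mult₂-++ []      M j = refl
mult₂-++ (x ∷ L) M j = trans (cong (e x j xor_) (mult₂-++ L M j)) (sym (xor-assoc (e x j) _ _))

mult₂-map-injective : {f : Fin n → Fin n} → Injective _≡_ _≡_ f →
  (L : List (Fin n)) (j : Fin n) → mult₂ (map f L) (f j) ≡ mult₂ L j
mult₂-map-injective inj []      j = refl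
mult₂-map-injective inj (x ∷ L) j = cong₂ _xor_ (e-injective inj x j) (mult₂-map-injective inj L j)

∑-mult₂ : (L : List (Fin n)) (F : Fin n → Bool) → ∑[ q < n ] (mult₂ L q ∧ F q) ≡ ⊕ (map F L)
∑-mult₂ {n} []      F = sum-replicate-zero n
∑-mult₂ {n} (x ∷ L) F = begin
  ∑[ q < n ] ((e x q xor mult₂ L q) ∧ F q)                 ≡⟨ sum-cong-≗ (λ q → ∧-distribʳ-xor (F q) (e x q) (mult₂ L q)) ⟩
  ∑[ q < n ] (e x q ∧ F q xor mult₂ L q ∧ F q)             ≡⟨ ∑-distrib-+ (λ q → e x q ∧ F q) (λ q → mult₂ L q ∧ F q) ⟩
  ∑[ q < n ] (e x q ∧ F q) xor ∑[ q < n ] (mult₂ L q ∧ F q) ≡⟨ cong₂ _xor_ (∑-sift x F) (∑-mult₂ L F) ⟩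
  F x xor ⊕ (map F L)                                      ∎

⊕-++ : (L M : List Bool) → ⊕ (L ++ M) ≡ ⊕ L xor ⊕ M
⊕-++ []      M = refl
⊕-++ (b ∷ L) M = trans (cong (b xor_) (⊕-++ L M)) (sym (xor-assoc b (⊕ L) (⊕ M)))

⊕-map-xor : {A : Set} (F G : A → Bool) (L : List A) →
  ⊕ (map (λ l → F l xor G l) L) ≡ ⊕ (map F L) xor ⊕ (map G L)
⊕-map-xor F G []      = refl
⊕-map-xor F G (x ∷ L) = trans (cong ((F x xor G x) xor_) (⊕-map-xor F G L)) (interchange (F x) (G x) _ _)

word : List (Fin n) → H n
word L = prodH (map xH L)

word-vec : (L : List (Fin n)) → proj₁ (word L) ≡ mult₂ L
word-vec []      = refl
word-vec (x ∷ L) = cong (e x +V_) (word-vec L)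

word-parity-∷ : (x : Fin n) (L : List (Fin n)) →
  proj₂ (word (x ∷ L)) ≡ proj₂ (word L) xor ⊕ (map (λ l → ⌊ x <? l ⌋) L)
word-parity-∷ {n} x L = cong (proj₂ (word L) xor_) (begin
  pairSum (e x) (proj₁ (word L))          ≡⟨ cong (pairSum (e x)) (word-vec L) ⟩
  pairSum (e x) (mult₂ L)                 ≡⟨ pairSum-e x (mult₂ L) ⟩
  ∑[ q < n ] (⌊ x <? q ⌋ ∧ mult₂ L q)     ≡⟨ sum-cong-≗ (λ q → ∧-comm ⌊ x <? q ⌋ (mult₂ L q)) ⟩
  ∑[ q < n ] (mult₂ L q ∧ ⌊ x <? q ⌋)     ≡⟨ ∑-mult₂ L (λ q → ⌊ x <? q ⌋) ⟩
  ⊕ (map (λ l → ⌊ x <? l ⌋) L)            ∎)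

word-parity-∷ʳ : (L : List (Fin n)) (y : Fin n) →
  proj₂ (word (L ++ [ y ])) ≡ proj₂ (word L) xor ⊕ (map (λ l → ⌊ l <? y ⌋) L)
word-parity-∷ʳ []      y = word-parity-∷ y []
word-parity-∷ʳ (x ∷ L) y = begin
  proj₂ (word (x ∷ L ++ [ y ]))                       ≡⟨ word-parity-∷ x (L ++ [ y ]) ⟩
  proj₂ (word (L ++ [ y ])) xor ⊕ (map x<_ (L ++ [ y ])) ≡⟨ cong₂ _xor_ (word-parity-∷ʳ L y)
                                                            (trans (cong ⊕ (map-++ x<_ L [ y ])) (⊕-++ (map x<_ L) [ ⌊ x <? y ⌋ ])) ⟩
  (w xor a) xor (b xor (⌊ x <? y ⌋ xor false))      ≡⟨ rearrange w a b ⌊ x <? y ⌋ ⟩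
  (w xor b) xor (⌊ x <? y ⌋ xor a)                  ≡⟨ cong (_xor (⌊ x <? y ⌋ xor a)) (word-parity-∷ x L) ⟨
  proj₂ (word (x ∷ L)) xor ⊕ (map _<y (x ∷ L))     ∎
  where
  x<_ _<y : Fin _ → Bool
  x<_ l = ⌊ x <? l ⌋
  _<y l = ⌊ l <? y ⌋
  w a b : Bool
  w = proj₂ (word L)
  a = ⊕ (map _<y L)
  b = ⊕ (map x<_ L)
  rearrange : ∀ w a b c → (w xor a) xor (b xor (c xor false)) ≡ (w xor b) xor (c xor a)
  rearrange = solve-∀ xor-∧-almostCommutativeRing

quad : (Fin n → Fin n → Bool) → V n → Bool
quad β a = ∑₂ (λ p q → a p ∧ a q ∧ β p q)

quad-cong : (β : Fin n → Fin n → Bool) {a a′ : V n} → (∀ p → a p ≡ a′ p) → quad β a ≡ quad β a′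
quad-cong β a≗a′ = ∑₂-cong (λ p q → cong₂ (λ u v → u ∧ v ∧ β p q) (a≗a′ p) (a≗a′ q))

quad-vanishing : {β : Fin n → Fin n → Bool} → (∀ p q → β p q ≡ false) → (a : V n) → quad β a ≡ false
quad-vanishing {n} β≡false a = ∑₂-false {n} (λ p q →
  trans (cong (λ u → a p ∧ a q ∧ u) (β≡false p q)) (trans (cong (a p ∧_) (∧-zeroʳ (a q))) (∧-zeroʳ (a p))))

quad-zero : (β : Fin n → Fin n → Bool) → quad β 0V ≡ false
quad-zero {n} β = ∑₂-false {n} (λ p q → refl)

quad-e+ : (β : Fin n → Fin n → Bool) (x : Fin n) (a : V n) →
  quad β (e x +V a) ≡ (quad β a xor ∑[ q < n ] (a q ∧ (β x q xor β q x))) xor β x x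
quad-e+ {n} β x a = begin
  quad β (e x +V a)
    ≡⟨ ∑₂-cong (λ p q → expand (e x p) (a p) (e x q) (a q) (β p q)) ⟩
  ∑₂ (λ p q → ((aa p q xor ea p q) xor ae p q) xor ee p q)
    ≡⟨ trans (∑₂-distrib-xor _ ee) (cong (_xor ∑₂ ee) (trans (∑₂-distrib-xor _ ae) (cong (_xor ∑₂ ae) (∑₂-distrib-xor aa ea)))) ⟩
  ((quad β a xor ∑₂ ea) xor ∑₂ ae) xor ∑₂ ee
    ≡⟨ cong (_xor ∑₂ ee) (xor-assoc (quad β a) (∑₂ ea) (∑₂ ae)) ⟩
  (quad β a xor (∑₂ ea xor ∑₂ ae)) xor ∑₂ ee
    ≡⟨ cong₂ (λ u v → (quad β a xor u) xor v) cross-terms ∑₂-ee ⟩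
  (quad β a xor ∑[ q < n ] (a q ∧ (β x q xor β q x))) xor β x x
    ∎
  where
  aa ea ae ee : Fin n → Fin n → Bool
  aa p q = a p ∧ a q ∧ β p q
  ea p q = e x p ∧ a q ∧ β p q
  ae p q = e x q ∧ a p ∧ β p q
  ee p q = e x p ∧ e x q ∧ β p q
  expand : ∀ xp ap xq aq b →
    (xp xor ap) ∧ (xq xor aq) ∧ b ≡ ((ap ∧ aq ∧ b xor xp ∧ aq ∧ b) xor xq ∧ ap ∧ b) xor xp ∧ xq ∧ b
  expand = solve-∀ xor-∧-almostCommutativeRing
  ∑₂-ea : ∑₂ ea ≡ ∑[ q < n ] (a q ∧ β x q)
  ∑₂-ea = begin
    ∑₂ ea                                     ≡⟨ sum-cong-≗ (λ p → *-distribˡ-sum (e x p) (λ q → a q ∧ β p q)) ⟨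
    ∑[ p < n ] (e x p ∧ ∑[ q < n ] (a q ∧ β p q)) ≡⟨ ∑-sift x (λ p → ∑[ q < n ] (a q ∧ β p q)) ⟩
    ∑[ q < n ] (a q ∧ β x q)                  ∎
  ∑₂-ae : ∑₂ ae ≡ ∑[ p < n ] (a p ∧ β p x)
  ∑₂-ae = sum-cong-≗ (λ p → ∑-sift x (λ q → a p ∧ β p q))
  ∑₂-ee : ∑₂ ee ≡ β x x
  ∑₂-ee = begin
    ∑₂ ee                                         ≡⟨ sum-cong-≗ (λ p → *-distribˡ-sum (e x p) (λ q → e x q ∧ β p q)) ⟨
    ∑[ p < n ] (e x p ∧ ∑[ q < n ] (e x q ∧ β p q)) ≡⟨ sum-cong-≗ (λ p → cong (e x p ∧_) (∑-sift x (β p))) ⟩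
    ∑[ p < n ] (e x p ∧ β p x)                    ≡⟨ ∑-sift x (λ p → β p x) ⟩
    β x x                                         ∎
  cross-terms : (∑₂ ea xor ∑₂ ae) ≡ ∑[ q < n ] (a q ∧ (β x q xor β q x))
  cross-terms = begin
    ∑₂ ea xor ∑₂ ae                                   ≡⟨ cong₂ _xor_ ∑₂-ea ∑₂-ae ⟩
    ∑[ q < n ] (a q ∧ β x q) xor ∑[ q < n ] (a q ∧ β q x) ≡⟨ ∑-distrib-+ (λ q → a q ∧ β x q) (λ q → a q ∧ β q x) ⟨
    ∑[ q < n ] (a q ∧ β x q xor a q ∧ β q x)          ≡⟨ sum-cong-≗ (λ q → ∧-distribˡ-xor (a q) (β x q) (β q x)) ⟨
    ∑[ q < n ] (a q ∧ (β x q xor β q x))              ∎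

flips : (Fin n → Fin n) → Fin n → Fin n → Bool
flips f p q = ⌊ f p <? f q ⌋ xor ⌊ p <? q ⌋

inversion : (Fin n → Fin n) → Fin n → Fin n → Bool
inversion f p q = ⌊ p <? q ⌋ ∧ flips f p q

invParity : (Fin n → Fin n) → V n → Bool
invParity f = quad (inversion f)

invParity-cong : {f f′ : Fin n → Fin n} → (∀ p → f p ≡ f′ p) → (a : V n) → invParity f a ≡ invParity f′ a
invParity-cong f≗f′ a = ∑₂-cong (λ p q →
  cong (λ u → a p ∧ a q ∧ ⌊ p <? q ⌋ ∧ u) (cong₂ (λ s t → ⌊ s <? t ⌋ xor ⌊ p <? q ⌋) (f≗f′ p) (f≗f′ q)))

invParity-id : {f : Fin n → Fin n} → (∀ p → f p ≡ p) → (a : V n) → invParity f a ≡ false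
invParity-id {f = f} f≗id = quad-vanishing (λ p q → begin
  ⌊ p <? q ⌋ ∧ (⌊ f p <? f q ⌋ xor ⌊ p <? q ⌋) ≡⟨ cong₂ (λ s t → ⌊ p <? q ⌋ ∧ (⌊ s <? t ⌋ xor ⌊ p <? q ⌋)) (f≗id p) (f≗id q) ⟩
  ⌊ p <? q ⌋ ∧ (⌊ p <? q ⌋ xor ⌊ p <? q ⌋)     ≡⟨ cong (⌊ p <? q ⌋ ∧_) (xor-same ⌊ p <? q ⌋) ⟩
  ⌊ p <? q ⌋ ∧ false                           ≡⟨ ∧-zeroʳ ⌊ p <? q ⌋ ⟩
  false                                        ∎)

inversion-diag : (f : Fin n → Fin n) (x : Fin n) → inversion f x x ≡ false
inversion-diag f x = cong (_∧ flips f x x) (<?-irrefl x)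

inversion-polar : {f : Fin n → Fin n} → Injective _≡_ _≡_ f → (x y : Fin n) →
  inversion f x y xor inversion f y x ≡ flips f x y
inversion-polar {f = f} inj x y with x ≟ y
... | yes refl = trans (xor-same (inversion f x x)) (sym (cong₂ _xor_ (<?-irrefl (f x)) (<?-irrefl x)))
... | no x≢y   = begin
  s ∧ (t xor s) xor ⌊ y <? x ⌋ ∧ (⌊ f y <? f x ⌋ xor ⌊ y <? x ⌋)
    ≡⟨ cong₂ (λ s′ t′ → s ∧ (t xor s) xor s′ ∧ (t′ xor s′)) (<?-swap x≢y) (<?-swap (x≢y ∘ inj)) ⟩
  s ∧ (t xor s) xor not s ∧ (not t xor not s)
    ≡⟨ cong (λ u → s ∧ (t xor s) xor not s ∧ u) (xor-annihilates-not t s) ⟩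
  s ∧ (t xor s) xor not s ∧ (t xor s)
    ≡⟨ split s (t xor s) ⟩
  t xor s
    ∎
  where
  s t : Bool
  s = ⌊ x <? y ⌋
  t = ⌊ f x <? f y ⌋
  split : ∀ s u → s ∧ u xor not s ∧ u ≡ u
  split true  u = xor-identityʳ u
  split false u = refl

invParity-e+ : {f : Fin n → Fin n} → Injective _≡_ _≡_ f → (x : Fin n) (a : V n) →
  invParity f (e x +V a) ≡ invParity f a xor ∑[ q < n ] (a q ∧ flips f x q)
invParity-e+ {n} {f} inj x a = begin
  invParity f (e x +V a)
    ≡⟨ quad-e+ (inversion f) x a ⟩
  (invParity f a xor ∑[ q < n ] (a q ∧ (inversion f x q xor inversion f q x))) xor inversion f x x
    ≡⟨ cong₂ (λ s t → (invParity f a xor s) xor t)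
         (sum-cong-≗ (λ q → cong (a q ∧_) (inversion-polar inj x q))) (inversion-diag f x) ⟩
  (invParity f a xor ∑[ q < n ] (a q ∧ flips f x q)) xor false
    ≡⟨ xor-identityʳ _ ⟩
  invParity f a xor ∑[ q < n ] (a q ∧ flips f x q)
    ∎

word-parity-map : {f : Fin n → Fin n} → Injective _≡_ _≡_ f → (L : List (Fin n)) →
  proj₂ (word (map f L)) xor proj₂ (word L) ≡ invParity f (mult₂ L)
word-parity-map {n} {f} inj []      = sym (quad-zero (inversion f))
word-parity-map {n} {f} inj (x ∷ L) = begin
  proj₂ (word (f x ∷ map f L)) xor proj₂ (word (x ∷ L))
    ≡⟨ cong₂ _xor_ (word-parity-∷ (f x) (map f L)) (word-parity-∷ x L) ⟩
  (wf xor ⊕ (map (λ l → ⌊ f x <? l ⌋) (map f L))) xor (w xor ⊕ (map (λ l → ⌊ x <? l ⌋) L))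
    ≡⟨ interchange wf _ w _ ⟩
  (wf xor w) xor (⊕ (map (λ l → ⌊ f x <? l ⌋) (map f L)) xor ⊕ (map (λ l → ⌊ x <? l ⌋) L))
    ≡⟨ cong₂ _xor_ (word-parity-map inj L)
         (trans (cong (λ M → ⊕ M xor ⊕ (map (λ l → ⌊ x <? l ⌋) L)) (sym (map-∘ L)))
                (sym (⊕-map-xor (λ l → ⌊ f x <? f l ⌋) (λ l → ⌊ x <? l ⌋) L))) ⟩
  invParity f (mult₂ L) xor ⊕ (map (flips f x) L)
    ≡⟨ cong (invParity f (mult₂ L) xor_) (∑-mult₂ L (flips f x)) ⟨
  invParity f (mult₂ L) xor ∑[ q < n ] (mult₂ L q ∧ flips f x q)
    ≡⟨ invParity-e+ inj x (mult₂ L) ⟨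
  invParity f (e x +V mult₂ L)
    ∎
  where
  wf w : Bool
  wf = proj₂ (word (map f L))
  w  = proj₂ (word L)

support : V n → List (Fin n)
support {n} a = filterᵇ a (allFin n)

·H-identityˡ : (h : H n) → 1H ·H h ≡ h
·H-identityˡ (a , b) = cong (a ,_) (trans (cong (b xor_) (pairSum-zeroˡ a)) (xor-identityʳ b))

wordH-support : (f : Fin n → Fin n) (a : V n) → wordH f a ≡ word (map f (support a))
wordH-support {n} f a = go (allFin n)
  where
  go : (L : List (Fin n)) →
    prodH (map (λ i → if a i then xH (f i) else 1H) L) ≡ word (map f (filterᵇ a L))
  go []      = refl
  go (x ∷ L) with a x
  ... | true  = cong (xH (f x) ·H_) (go L)
  ... | false = trans (·H-identityˡ _) (go L)

mult₂-support : (a : V n) (j : Fin n) → mult₂ (support a) j ≡ a j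
mult₂-support {n} a j = begin
  mult₂ (filterᵇ a (allFin n)) j              ≡⟨ go (allFin n) ⟩
  ⊕ (map (λ p → a p ∧ e p j) (allFin n))      ≡⟨ ⊕-allFin (λ p → a p ∧ e p j) ⟩
  ∑[ p < n ] (a p ∧ e p j)                    ≡⟨ sum-cong-≗ (λ p → trans (∧-comm (a p) (e p j)) (cong (_∧ a p) (e-sym p j))) ⟩
  ∑[ p < n ] (e j p ∧ a p)                    ≡⟨ ∑-sift j a ⟩
  a j                                         ∎
  where
  go : (L : List (Fin n)) → mult₂ (filterᵇ a L) j ≡ ⊕ (map (λ p → a p ∧ e p j) L)
  go []      = refl
  go (x ∷ L) with a x
  ... | true  = cong (e x j xor_) (go L)
  ... | false = go L

infix 4 _≈H_
_≈H_ : H n → H n → Set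
h ≈H h′ = (∀ j → proj₁ h j ≡ proj₁ h′ j) × (proj₂ h ≡ proj₂ h′)

≈H-sym : {h h′ : H n} → h ≈H h′ → h′ ≈H h
≈H-sym (a≗a′ , b≡b′) = (λ j → sym (a≗a′ j)) , sym b≡b′

≈H-trans : {h₁ h₂ h₃ : H n} → h₁ ≈H h₂ → h₂ ≈H h₃ → h₁ ≈H h₃
≈H-trans (a₁≗a₂ , b₁≡b₂) (a₂≗a₃ , b₂≡b₃) = (λ j → trans (a₁≗a₂ j) (a₂≗a₃ j)) , trans b₁≡b₂ b₂≡b₃

·H-cong : {h₁ h₁′ h₂ h₂′ : H n} → h₁ ≈H h₁′ → h₂ ≈H h₂′ → h₁ ·H h₂ ≈H h₁′ ·H h₂′
·H-cong (a₁≗ , b₁≡) (a₂≗ , b₂≡) =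
  (λ j → cong₂ _xor_ (a₁≗ j) (a₂≗ j)) , cong₂ _xor_ (cong₂ _xor_ b₁≡ b₂≡) (pairSum-cong a₁≗ a₂≗)

invH-cong : {h h′ : H n} → h ≈H h′ → invH h ≈H invH h′
invH-cong (a≗ , b≡) = a≗ , cong₂ _xor_ b≡ (pairSum-cong a≗ a≗)

perm-injective : (π : Perm n) → Injective _≡_ _≡_ (π ⟨$⟩ʳ_)
perm-injective π = Injection.injective (↔⇒↣ π)

⟨$⟩ˡ-trivial : {π : Perm n} → (∀ j → π ⟨$⟩ʳ j ≡ j) → ∀ j → π ⟨$⟩ˡ j ≡ j
⟨$⟩ˡ-trivial {π = π} π≗id j = trans (sym (π≗id (π ⟨$⟩ˡ j))) (inverseʳ π)

actH-≈ : (π : Perm n) (a : V n) (b : Bool) →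
  actH π (a , b) ≈H ((λ j → a (π ⟨$⟩ˡ j)) , b xor invParity (π ⟨$⟩ʳ_) a)
actH-≈ {n} π a b = vec , parity
  where
  f : Fin n → Fin n
  f = π ⟨$⟩ʳ_
  N : List (Fin n)
  N = support a
  vec : ∀ j → proj₁ (wordH f a) j xor false ≡ a (π ⟨$⟩ˡ j)
  vec j = begin
    proj₁ (wordH f a) j xor false       ≡⟨ xor-identityʳ _ ⟩
    proj₁ (wordH f a) j                 ≡⟨ cong (λ h → proj₁ h j) (wordH-support f a) ⟩
    proj₁ (word (map f N)) j            ≡⟨ cong (λ v → v j) (word-vec (map f N)) ⟩
    mult₂ (map f N) j                   ≡⟨ cong (mult₂ (map f N)) (inverseʳ π) ⟨
    mult₂ (map f N) (f (π ⟨$⟩ˡ j))      ≡⟨ mult₂-map-injective (perm-injective π) N (π ⟨$⟩ˡ j) ⟩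
    mult₂ N (π ⟨$⟩ˡ j)                  ≡⟨ mult₂-support a (π ⟨$⟩ˡ j) ⟩
    a (π ⟨$⟩ˡ j)                        ∎
  wₚ w : Bool
  wₚ = proj₂ (wordH f a)
  w  = proj₂ (wordH (λ i → i) a)
  parity : (wₚ xor (b xor w)) xor pairSum (proj₁ (wordH f a)) 0V ≡ b xor invParity f a
  parity = begin
    (wₚ xor (b xor w)) xor pairSum (proj₁ (wordH f a)) 0V  ≡⟨ cong ((wₚ xor (b xor w)) xor_) (pairSum-zeroʳ (proj₁ (wordH f a))) ⟩
    (wₚ xor (b xor w)) xor false                           ≡⟨ xor-identityʳ _ ⟩
    wₚ xor (b xor w)                                       ≡⟨ x∙yz≈y∙xz wₚ b w ⟩
    b xor (wₚ xor w)                                       ≡⟨ cong (b xor_) (cong₂ (λ u v → proj₂ u xor proj₂ v)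
                                                               (wordH-support f a)
                                                               (trans (wordH-support (λ i → i) a) (cong word (map-id N)))) ⟩
    b xor (proj₂ (word (map f N)) xor proj₂ (word N))      ≡⟨ cong (b xor_) (word-parity-map (perm-injective π) N) ⟩
    b xor invParity f (mult₂ N)                            ≡⟨ cong (b xor_) (quad-cong (inversion f) (mult₂-support a)) ⟩
    b xor invParity f a                                    ∎

actH-cong : (π : Perm n) {h h′ : H n} → h ≈H h′ → actH π h ≈H actH π h′
actH-cong π {a , b} {a′ , b′} (a≗a′ , b≡b′) =
  ≈H-trans (actH-≈ π a b)
    (≈H-trans ((λ j → a≗a′ (π ⟨$⟩ˡ j)) , cong₂ _xor_ b≡b′ (quad-cong (inversion (π ⟨$⟩ʳ_)) a≗a′))
      (≈H-sym (actH-≈ π a′ b′)))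

actH-central : (π : Perm n) {a : V n} (b : Bool) → (∀ j → a j ≡ false) → actH π (a , b) ≈H (0V , b)
actH-central π {a} b a≗0 = ≈H-trans (actH-≈ π a b)
  ((λ j → a≗0 (π ⟨$⟩ˡ j)) ,
   trans (cong (b xor_) (trans (quad-cong (inversion (π ⟨$⟩ʳ_)) a≗0) (quad-zero (inversion (π ⟨$⟩ʳ_)))))
         (xor-identityʳ b))

actH-trivial : {π : Perm n} → (∀ j → π ⟨$⟩ʳ j ≡ j) → (h : H n) → actH π h ≈H h
actH-trivial {π = π} π≗id (a , b) = ≈H-trans (actH-≈ π a b)
  ((λ j → cong a (⟨$⟩ˡ-trivial {π = π} π≗id j)) ,
   trans (cong (b xor_) (invParity-id π≗id a)) (xor-identityʳ b))

Fixes : Perm n → V n → Set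
Fixes π v = ∀ j → v (π ⟨$⟩ʳ j) ≡ v j

commG-lifts : (π : Perm n) (v : V n) → Fixes π v →
  (g₁ g₂ : G n) → IsLift g₁ (inS π) → IsLift g₂ (inV v) →
  (h : H n) → (0V , invParity (π ⟨$⟩ʳ_) v) ≈H h → commG g₁ g₂ ≈G inH h
commG-lifts {n} π v π-fixes ((a₁ , b₁) , π₁) ((a₂ , b₂) , ρ) (a₁≗0 , π₁≗π) (a₂≗v , ρ≗id) h Q≈h =
  proj₁ H-part , proj₂ H-part , perm-part
  where
  Q P : Bool
  Q = invParity (π ⟨$⟩ʳ_) v
  P = pairSum v v
  π₁-fixes : ∀ j → v (π₁ ⟨$⟩ˡ j) ≡ v j
  π₁-fixes j = begin
    v (π₁ ⟨$⟩ˡ j)               ≡⟨ π-fixes (π₁ ⟨$⟩ˡ j) ⟨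
    v (π ⟨$⟩ʳ (π₁ ⟨$⟩ˡ j))      ≡⟨ cong v (π₁≗π (π₁ ⟨$⟩ˡ j)) ⟨
    v (π₁ ⟨$⟩ʳ (π₁ ⟨$⟩ˡ j))     ≡⟨ cong v (inverseʳ π₁) ⟩
    v j                         ∎
  π₁·h₂≈ : actH π₁ (a₂ , b₂) ≈H (v , b₂ xor Q)
  π₁·h₂≈ = ≈H-trans (actH-≈ π₁ a₂ b₂)
    ((λ j → trans (a₂≗v (π₁ ⟨$⟩ˡ j)) (π₁-fixes j)) ,
     cong (b₂ xor_) (trans (quad-cong (inversion (π₁ ⟨$⟩ʳ_)) a₂≗v) (invParity-cong π₁≗π v)))
  h₁⁻¹-term≈ : actH (π₁ ·S ρ) (actH (flip π₁) (invH (a₁ , b₁))) ≈H (0V , b₁)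
  h₁⁻¹-term≈ = ≈H-trans (actH-cong (π₁ ·S ρ) (actH-central (flip π₁) (b₁ xor pairSum a₁ a₁) a₁≗0))
    (≈H-trans (actH-central (π₁ ·S ρ) (b₁ xor pairSum a₁ a₁) (λ _ → refl))
      ((λ _ → refl) , trans (cong (b₁ xor_) (trans (pairSum-cong a₁≗0 a₁≗0) (pairSum-zeroˡ {n} 0V))) (xor-identityʳ b₁)))
  ρ⁻¹-trivial : ∀ x → flip ρ ⟨$⟩ʳ x ≡ x
  ρ⁻¹-trivial = ⟨$⟩ˡ-trivial {π = ρ} ρ≗id
  conj-ρ-trivial : ∀ x → ((π₁ ·S ρ) ·S flip π₁) ⟨$⟩ʳ x ≡ x
  conj-ρ-trivial x = trans (cong (π₁ ⟨$⟩ʳ_) (ρ≗id (π₁ ⟨$⟩ˡ x))) (inverseʳ π₁)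
  perm-part : ∀ x → (((π₁ ·S ρ) ·S flip π₁) ·S flip ρ) ⟨$⟩ʳ x ≡ x
  perm-part x = trans (conj-ρ-trivial (flip ρ ⟨$⟩ʳ x)) (ρ⁻¹-trivial x)
  h₂⁻¹-term≈ : actH ((π₁ ·S ρ) ·S flip π₁) (actH (flip ρ) (invH (a₂ , b₂))) ≈H (v , b₂ xor P)
  h₂⁻¹-term≈ = ≈H-trans (actH-trivial {π = (π₁ ·S ρ) ·S flip π₁} conj-ρ-trivial (actH (flip ρ) (invH (a₂ , b₂))))
    (≈H-trans (actH-trivial {π = flip ρ} ρ⁻¹-trivial (invH (a₂ , b₂)))
      (a₂≗v , cong (b₂ xor_) (pairSum-cong a₂≗v a₂≗v)))
  collapse : (((0V , b₁) ·H (v , b₂ xor Q)) ·H (0V , b₁)) ·H (v , b₂ xor P) ≈H (0V , Q)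
  collapse =
    (λ j → trans (cong (_xor v j) (xor-identityʳ (v j))) (xor-same (v j))) ,
    (begin
      (((((b₁ xor (b₂ xor Q)) xor pairSum 0V v) xor b₁) xor pairSum v 0V) xor (b₂ xor P)) xor pairSum (v +V 0V) v
        ≡⟨ cong₂ _xor_
             (cong₂ (λ s t → ((((b₁ xor (b₂ xor Q)) xor s) xor b₁) xor t) xor (b₂ xor P)) (pairSum-zeroˡ v) (pairSum-zeroʳ v))
             (pairSum-cong (λ j → xor-identityʳ (v j)) (λ _ → refl)) ⟩
      (((((b₁ xor (b₂ xor Q)) xor false) xor b₁) xor false) xor (b₂ xor P)) xor P
        ≡⟨ cancel b₁ b₂ Q P ⟩
      Q ∎)
    where
    cancel : ∀ b₁ b₂ Q P → (((((b₁ xor (b₂ xor Q)) xor false) xor b₁) xor false) xor (b₂ xor P)) xor P ≡ Q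
    cancel = solve-∀ xor-∧-almostCommutativeRing
  H-part : (((a₁ , b₁) ·H actH π₁ (a₂ , b₂)) ·H actH (π₁ ·S ρ) (actH (flip π₁) (invH (a₁ , b₁))))
              ·H actH ((π₁ ·S ρ) ·S flip π₁) (actH (flip ρ) (invH (a₂ , b₂))) ≈H h
  H-part = ≈H-trans (·H-cong (·H-cong (·H-cong {h₁′ = 0V , b₁} (a₁≗0 , refl) π₁·h₂≈) h₁⁻¹-term≈) h₂⁻¹-term≈)
             (≈H-trans collapse Q≈h)

epsPow-vec : (m : ℕ) (j : Fin n) → proj₁ (epsPow {n} m) j ≡ false
epsPow-vec zero    j = refl
epsPow-vec (suc m) j = epsPow-vec m j

epsPow-parity : (m : ℕ) → proj₂ (epsPow {n} m) ≡ ⊕ (tabulate {n = m} (λ _ → true))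
epsPow-parity zero    = refl
epsPow-parity {n} (suc m) = begin
  (true xor w) xor pairSum 0V (proj₁ (epsPow {n} m))  ≡⟨ cong ((true xor w) xor_) (pairSum-zeroˡ (proj₁ (epsPow {n} m))) ⟩
  (true xor w) xor false                              ≡⟨ xor-identityʳ (true xor w) ⟩
  true xor w                                          ≡⟨ cong (true xor_) (epsPow-parity m) ⟩
  true xor ⊕ (tabulate {n = m} (λ _ → true))          ∎
  where
  w : Bool
  w = proj₂ (epsPow {n} m)

sumE≡mult₂ : ∀ {m} (i : Fin m → Fin n) → sumE i ≡ mult₂ (map i (allFin m))
sumE≡mult₂ {m = m} i = cong (foldr _+V_ 0V) (map-∘ (allFin m))

fixes-mult₂ : (π : Perm n) (L : List (Fin n)) →
  (∀ j → mult₂ (map (π ⟨$⟩ʳ_) L) j ≡ mult₂ L j) → Fixes π (mult₂ L)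
fixes-mult₂ π L π-permutes j = trans (sym (π-permutes (π ⟨$⟩ʳ j))) (mult₂-map-injective (perm-injective π) L j)

sucIfNonzero : ∀ {m} → Fin (suc m) → Fin (suc (suc m))
sucIfNonzero zero    = zero
sucIfNonzero (suc j) = suc (suc j)

next-suc : ∀ {m} (j : Fin (suc m)) → next (suc j) ≡ sucIfNonzero (next j)
next-suc {m} j with next {m} j
... | zero  = refl
... | suc _ = refl

map-next-allFin : ∀ m → map next (allFin (suc m)) ≡ tabulate {n = m} suc ++ [ zero ]
map-next-allFin zero    = refl
map-next-allFin (suc m) = cong (suc zero ∷_) (begin
  map next (tabulate suc)                            ≡⟨ map-tabulate suc next ⟩
  tabulate (next ∘ suc)                              ≡⟨ tabulate-cong next-suc ⟩
  tabulate (sucIfNonzero ∘ next)                     ≡⟨ map-tabulate next sucIfNonzero ⟨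
  map sucIfNonzero (tabulate next)                   ≡⟨ cong (map sucIfNonzero) (map-tabulate (λ j → j) next) ⟨
  map sucIfNonzero (map next (allFin (suc m)))       ≡⟨ cong (map sucIfNonzero) (map-next-allFin m) ⟩
  map sucIfNonzero (tabulate suc ++ [ zero ])        ≡⟨ map-++ sucIfNonzero (tabulate suc) [ zero ] ⟩
  map sucIfNonzero (tabulate suc) ++ [ zero ]        ≡⟨ cong (_++ [ zero ]) (map-tabulate suc sucIfNonzero) ⟩
  tabulate (λ j → suc (suc j)) ++ [ zero ]           ∎)

module _ {m : ℕ} (i : Fin (suc m) → Fin n) where

  private
    C R : List (Fin n)
    C = map i (allFin (suc m))
    R = map i (tabulate suc)

  cycle-rotates : {σ : Perm n} → IsCycle i σ → map (σ ⟨$⟩ʳ_) C ≡ R ++ [ i zero ]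
  cycle-rotates {σ} (_ , σ∘i≗i∘next , _) = begin
    map (σ ⟨$⟩ʳ_) (map i (allFin (suc m)))    ≡⟨ map-∘ (allFin (suc m)) ⟨
    map ((σ ⟨$⟩ʳ_) ∘ i) (allFin (suc m))      ≡⟨ map-cong σ∘i≗i∘next (allFin (suc m)) ⟩
    map (i ∘ next) (allFin (suc m))           ≡⟨ map-∘ (allFin (suc m)) ⟩
    map i (map next (allFin (suc m)))         ≡⟨ cong (map i) (map-next-allFin m) ⟩
    map i (tabulate suc ++ [ zero ])          ≡⟨ map-++ i (tabulate suc) [ zero ] ⟩
    R ++ [ i zero ]                           ∎

  cycle-fixes : {σ : Perm n} → IsCycle i σ → Fixes σ (sumE i)
  cycle-fixes {σ} σ-cycle = subst (Fixes σ) (sym (sumE≡mult₂ i)) (fixes-mult₂ σ C λ j → begin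
    mult₂ (map (σ ⟨$⟩ʳ_) C) j       ≡⟨ cong (λ L → mult₂ L j) (cycle-rotates {σ} σ-cycle) ⟩
    mult₂ (R ++ [ i zero ]) j       ≡⟨ mult₂-++ R [ i zero ] j ⟩
    mult₂ R j xor (e (i zero) j xor false) ≡⟨ cong (mult₂ R j xor_) (xor-identityʳ (e (i zero) j)) ⟩
    mult₂ R j xor e (i zero) j      ≡⟨ xor-comm (mult₂ R j) (e (i zero) j) ⟩
    mult₂ C j                       ∎)

  cycle-invParity : {σ : Perm n} → IsCycle i σ → invParity (σ ⟨$⟩ʳ_) (sumE i) ≡ proj₂ (epsPow {n} m)
  cycle-invParity {σ} σ-cycle@(i-injective , _) = begin
    invParity (σ ⟨$⟩ʳ_) (sumE i)
      ≡⟨ cong (invParity (σ ⟨$⟩ʳ_)) (sumE≡mult₂ i) ⟩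
    invParity (σ ⟨$⟩ʳ_) (mult₂ C)
      ≡⟨ word-parity-map (perm-injective σ) C ⟨
    proj₂ (word (map (σ ⟨$⟩ʳ_) C)) xor proj₂ (word C)
      ≡⟨ cong₂ _xor_ (trans (cong (proj₂ ∘ word) (cycle-rotates {σ} σ-cycle)) (word-parity-∷ʳ R (i zero)))
                      (word-parity-∷ (i zero) R) ⟩
    (proj₂ (word R) xor ⊕ (map (λ l → ⌊ l <? i zero ⌋) R)) xor (proj₂ (word R) xor ⊕ (map (λ l → ⌊ i zero <? l ⌋) R))
      ≡⟨ cancel (proj₂ (word R)) _ _ ⟩
    ⊕ (map (λ l → ⌊ l <? i zero ⌋) R) xor ⊕ (map (λ l → ⌊ i zero <? l ⌋) R)
      ≡⟨ ⊕-map-xor (λ l → ⌊ l <? i zero ⌋) (λ l → ⌊ i zero <? l ⌋) R ⟨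
    ⊕ (map (λ l → ⌊ l <? i zero ⌋ xor ⌊ i zero <? l ⌋) R)
      ≡⟨ cong ⊕ (trans (sym (map-∘ (tabulate suc))) (map-tabulate suc (λ k → ⌊ i k <? i zero ⌋ xor ⌊ i zero <? i k ⌋))) ⟩
    ⊕ (tabulate (λ k → ⌊ i (suc k) <? i zero ⌋ xor ⌊ i zero <? i (suc k) ⌋))
      ≡⟨ cong ⊕ (tabulate-cong (λ k → opposite {k} (λ ()))) ⟩
    ⊕ (tabulate {n = m} (λ _ → true))
      ≡⟨ epsPow-parity m ⟨
    proj₂ (epsPow m)
      ∎
    where
    cancel : ∀ w a b → (w xor a) xor (w xor b) ≡ a xor b
    cancel = solve-∀ xor-∧-almostCommutativeRing
    opposite : {k : Fin m} → suc k ≢ zero → ⌊ i (suc k) <? i zero ⌋ xor ⌊ i zero <? i (suc k) ⌋ ≡ true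
    opposite {k} k≢0 = trans (cong (⌊ i (suc k) <? i zero ⌋ xor_) (<?-swap (k≢0 ∘ i-injective)))
                             (xor-inverseʳ ⌊ i (suc k) <? i zero ⌋)

  module _ {α : Perm n} (α-fixes-i : ∀ j → α ⟨$⟩ʳ i j ≡ i j) where

    private
      α-fixes-C : map (α ⟨$⟩ʳ_) C ≡ C
      α-fixes-C = trans (sym (map-∘ (allFin (suc m)))) (map-cong α-fixes-i (allFin (suc m)))

    pointwise-fixes : Fixes α (sumE i)
    pointwise-fixes = subst (Fixes α) (sym (sumE≡mult₂ i)) (fixes-mult₂ α C (λ j → cong (λ L → mult₂ L j) α-fixes-C))

    pointwise-invParity : invParity (α ⟨$⟩ʳ_) (sumE i) ≡ false
    pointwise-invParity = begin
      invParity (α ⟨$⟩ʳ_) (sumE i)                         ≡⟨ cong (invParity (α ⟨$⟩ʳ_)) (sumE≡mult₂ i) ⟩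
      invParity (α ⟨$⟩ʳ_) (mult₂ C)                        ≡⟨ word-parity-map (perm-injective α) C ⟨
      proj₂ (word (map (α ⟨$⟩ʳ_) C)) xor proj₂ (word C)    ≡⟨ cong (λ L → proj₂ (word L) xor proj₂ (word C)) α-fixes-C ⟩
      proj₂ (word C) xor proj₂ (word C)                    ≡⟨ xor-same (proj₂ (word C)) ⟩
      false                                                ∎

proposition2p3 : (n : ℕ) → 1 ≤ n → (m : ℕ) → (i : Fin (suc m) → Fin n) → (σ : Perm n) →
    IsCycle i σ →
    ((g₁ g₂ : G n) → IsLift g₁ (inS σ) → IsLift g₂ (inV (sumE i)) →
      commG g₁ g₂ ≈G inH (epsPow m))
    × ((α : Perm n) → (∀ j → α ⟨$⟩ʳ i j ≡ i j) →
      (g₁ g₂ : G n) → IsLift g₁ (inS α) → IsLift g₂ (inV (sumE i)) →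
      commG g₁ g₂ ≈G inH 1H)
-- The hypothesis 1 ≤ n is implied by the existence of i : Fin (suc m) → Fin n.
proposition2p3 n _ m i σ σ-cycle =
  (λ g₁ g₂ lift₁ lift₂ → commG-lifts σ (sumE i) (cycle-fixes i {σ} σ-cycle) g₁ g₂ lift₁ lift₂
     (epsPow m) ((λ j → sym (epsPow-vec m j)) , cycle-invParity i {σ} σ-cycle)) ,
  (λ α α-fixes-i g₁ g₂ lift₁ lift₂ → commG-lifts α (sumE i) (pointwise-fixes i {α} α-fixes-i) g₁ g₂ lift₁ lift₂
     1H ((λ _ → refl) , pointwise-invParity i {α} α-fixes-i))
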